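{- Let $w$ be a finite OP word, $T_w=\tau(w)$ its unranked ordered tree, and $\varphi,\psi$ formulas of $\mathcal{X}_{until}$ such that for every position $i'$ of $w$, $(T_w,\tau(i'))\models\varphi$ iff $(w,i')\models\iota(\varphi)$, and $(T_w,\tau(i'))\models\psi$ iff $(w,i')\models\iota(\psi)$. Then for every position $i$ of $w$, $(T_w,\tau(i))\models\Downarrow(\varphi,\psi)$ iff $(w,i)\models\iota(\Downarrow(\varphi,\psi))$, where $\iota(\Downarrow(\varphi,\psi))=\bigcirc^d(\varphi'\,\mathcal{U}^d_\chi\,\psi')\lor\bigcirc^d_\chi(\varphi'\,\mathcal{U}^d_\chi\,\psi')$ with $\varphi'=\iota(\varphi)$, $\psi'=\iota(\psi)$.
   Context: OP words: $AP$ finite set of atomic propositions, $\Sigma=2^{AP}$, $\#\notin\Sigma$ a delimiter. An OPM $M$ is a partial function $(\Sigma\cup\{\#\})^2\to\{\lessdot,\doteq,\gtrdot\}$, writing $a\mathrel{\pi}b$ when $M(a,b)=\pi$; by convention $\#\lessdot a$, $a\gtrdot\#$. A simple chain is $c_0c_1\dots c_\ell c_{\ell+1}$ ($\ell\ge1$), $c_0,c_{\ell+1}\in\Sigma\cup\{\#\}$, $c_1..c_\ell\in\Sigma$, $c_0\lessdot c_1\doteq\dots\doteq c_\ell\gtrdot c_{\ell+1}$; a composed chain is $c_0s_0c_1\dots c_\ell s_\ell c_{\ell+1}$ with $c_0\dots c_{\ell+1}$ simple and each $s_k$ empty or $c_ks_kc_{k+1}$ a chain; $c_0,c_{\ell+1}$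 are left/right contexts. $w\in\Sigma^*$ is compatible with $M$ if $M$ is defined on consecutive letter pairs and on contexts of every chain that is a substring of $\#w\#$. A finite OP word is such $w=w_1\dots w_n$ on positions $\{0,\dots,n+1\}$ with $\#$ at $0,n+1$ (atomic proposition $\#$ true exactly there) and label $w_k$ at $k$; $i\mathrel{\pi}j$ compares labels; $\chi(i,j)$ iff $i<j-1$ and $i,j$ are left and right contexts of the same chain occurring in $\#w\#$. Trees: an unranked ordered tree (UOT) has node set $S$ of finite sequences of naturals, prefix-closed, with $s\cdot k\in S$, $k>0$ implying $s\cdot(k-1)\in S$; child relation $s R_\Downarrow s\cdot k$; next-sibling relation $r\cdot h\,R_\Rightarrow\,r\cdot(h+1)$; $R_\Uparrow,R_\Leftarrow$ are their inverses; nodes labeled by sets of atomic propositions. $R^+_\rho$ is the transitive closure. $\tau(w)$: position $0$ is the root; for each position $i$: if $i\doteq i+1$, $\tau(i+1)$ is the only child of $\tau(i)$; if $i\gtrdot i+1$, $\tau(i)$ is a leaf; if $i\lessdot i+1$, the children of $\tau(i)$ in order are $\tau(i+1),\tau(j_1),\dots,\tau(j_m)$ where $j_1<\dots<j_m$ are all positions with $\chi(i,j_k)$ and ($i\lessdot j_k$ or $i\doteq j_k$). Each node $\tau(i)$ gets the label of $i$. $\mathcal{X}_{until}$: $\varphi::=\mathrm{a}\mid\top\mid\neg\varphi\mid\varphi\land\varphi\mid\rho(\varphi,\varphi)$, $\rho\in\{\Downarrow,\Uparrow,\Rightarrow,\Leftarrow\}$; $(T,s)\models\rho(\varphi,\psi)$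 iff there is $t$ with $sR^+_\rho t$, $(T,t)\models\psi$, and every $r$ with $sR^+_\rho r$ and $rR^+_\rho t$ satisfies $\varphi$. POTL semantics at position $i$ (only operators needed): $\bigcirc^d\theta$: $i+1$ exists, ($i\lessdot i+1$ or $i\doteq i+1$), $\theta$ at $i+1$; $\ominus^d\theta$: $i\ge1$, ($i-1\lessdot i$ or $i-1\doteq i$), $\theta$ at $i-1$. $\bigcirc^d_\chi\theta$: some $j>i$, $\chi(i,j)$, ($i\lessdot j$ or $i\doteq j$), $\theta$ at $j$; $\ominus^d_\chi\theta$: some $j<i$, $\chi(j,i)$, ($j\lessdot i$ or $j\doteq i$), $\theta$ at $j$. DSP between $i\le j$: $i=i_1<\dots<i_n=j$ with $i_{p+1}=\max\{h\le j\mid\chi(i_p,h),\ i_p\lessdot h\text{ or }i_p\doteq h\}$ if nonempty, else $i_{p+1}=i_p+1$ with $i_p\lessdot i_p+1$ or $i_p\doteq i_p+1$. $\theta_1\,\mathcal{U}^d_\chi\,\theta_2$ at $i$: some $j\ge i$, DSP between $i$ and $j$, $\theta_2$ at $j$, $\theta_1$ at other path positions; $\theta_1\,\mathcal{S}^d_\chi\,\theta_2$: some $j\le i$, DSP between $j$ and $i$, $\theta_2$ at $j$, $\theta_1$ elsewhere. $\bigcirc^u_H\theta$: some $h<i$ with $\chi(h,i)$, $h\lessdot i$, and $j=\min\{k>i\mid\chi(h,k),h\lessdot k\}$ exists with $\theta$ at $j$; $\ominus^u_H\theta$: same with $j=\max\{k<i\mid\chi(h,k),h\lessdot k\}$. UHP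 between $i\le j$: $i=i_1<\dots<i_n=j$ with some $h<i$ s.t. $\chi(h,i_p)$, $h\lessdot i_p$ for all $p$, and no $k$ with $i_q<k<i_{q+1}$, $\chi(h,k)$. $\theta_1\,\mathcal{U}^u_H\,\theta_2$ at $i$: some $j\ge i$ and UHP between $i$ and $j$, $\theta_2$ at $j$, $\theta_1$ elsewhere; $\theta_1\,\mathcal{S}^u_H\,\theta_2$: some $j\le i$ and UHP between $j$ and $i$, $\theta_2$ at $j$, $\theta_1$ elsewhere. Restricted operators (POTL-definable as disjunctions over pairs of labels): $\bigcirc^{\pi}_\chi\theta$ ($\pi\in\{\lessdot,\doteq\}$): some $j$ with $\chi(i,j)$, $i\mathrel{\pi}j$, $\theta$ at $j$; $\ominus^{\pi}_\chi\theta$: some $j<i$ with $\chi(j,i)$, $j\mathrel{\pi}i$, $\theta$ at $j$; $\bigcirc^{\lessdot}\theta$: $i\lessdot i+1$ and $\theta$ at $i+1$; $\ominus^{\lessdot}\theta$: $i-1\lessdot i$ and $\theta$ at $i-1$. Translation $\iota$ from $\mathcal{X}_{until}$ to POTL, recursively, with $\varphi'=\iota(\varphi)$, $\psi'=\iota(\psi)$: identity on atomic propositions, $\top$, $\neg$, $\land$; $\iota(\Downarrow(\varphi,\psi))=\bigcirc^d(\varphi'\mathcal{U}^d_\chi\psi')\lor\bigcirc^d_\chi(\varphi'\mathcal{U}^d_\chi\psi')$; $\iota(\Uparrow(\varphi,\psi))=\ominus^d(\varphi'\mathcal{S}^d_\chi\psi')\lor\ominus^d_\chi(\varphi'\mathcal{S}^d_\chi\psi')$;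 $\iota(\Rightarrow(\varphi,\psi))=\bigcirc^u_H(\varphi'\mathcal{U}^u_H\psi')\lor(\neg\bigcirc^u_H(\top\,\mathcal{U}^u_H\neg\varphi')\land\ominus^{\lessdot}_\chi(\bigcirc^{\doteq}_\chi\psi'))\lor\ominus^{\lessdot}(\bigcirc^{\lessdot}_\chi(\psi'\land\neg\ominus^u_H(\top\,\mathcal{S}^u_H\neg\varphi')))\lor\ominus^{\lessdot}(\bigcirc^{\doteq}_\chi\psi'\land\neg\bigcirc^{\lessdot}_\chi\neg\varphi')$; $\iota(\Leftarrow(\varphi,\psi))=\ominus^u_H(\varphi'\mathcal{S}^u_H\psi')\lor\ominus^{\doteq}_\chi(\bigcirc^{\lessdot}_\chi(\neg\bigcirc^u_H\top\land\varphi'\mathcal{S}^u_H\psi'))\lor(\ominus^{\lessdot}_\chi(\bigcirc^{\lessdot}\psi')\land\neg\ominus^u_H(\top\,\mathcal{S}^u_H\neg\varphi'))\lor\ominus^{\doteq}_\chi(\bigcirc^{\lessdot}\psi'\land\neg\bigcirc^{\lessdot}_\chi\neg\varphi')$. -}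

module Defs where

open import Data.Nat using (ℕ; zero; suc; _≤_; _<_)
open import Data.Fin using (Fin)
open import Data.Fin.Subset using (Subset; _∈_)
open import Data.List using (List; []; _∷_)
open import Data.Maybe using (Maybe; just; nothing)
open import Data.Product using (Σ; _×_; _,_)
open import Data.Sum using (_⊎_)
open import Data.Unit using (⊤)
open import Data.Empty using (⊥)
open import Relation.Nullary using (¬_)
open import Relation.Binary.PropositionalEquality using (_≡_)
open import Relation.Binary.Construct.Closure.Transitive using (TransClosure)
open import Relation.Binary.Construct.Closure.ReflexiveTransitive using (Star)

-- Alphabet.  AP = Fin k (a finite set of atomic propositions),
-- Σ = 2^AP = Subset k, and the delimiter # ∉ Σ.

data Sym (k : ℕ) : Set where
  #   : Sym k
  `_  : Subset k → Sym k

data Prec : Set where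
  ⋖ ≐ ⋗ : Prec

-- An operator precedence matrix: a partial function (Σ ∪ {#})² → {⋖,≐,⋗}
-- (nothing = undefined), satisfying the convention # ⋖ a, a ⋗ # for a ∈ Σ.
record OPM (k : ℕ) : Set where
  field
    M        : Sym k → Sym k → Maybe Prec
    conv-#a  : ∀ a → M # (` a) ≡ just ⋖
    conv-a#  : ∀ a → M (` a) # ≡ just ⋗
open OPM public

-- Labels of the positions 0 .. n+1 of #w# (nothing = not a position).

posTail : ∀ {k} → List (Subset k) → ℕ → Maybe (Sym k)
posTail []      zero    = just #
posTail []      (suc _) = nothing
posTail (a ∷ w) zero    = just (` a)
posTail (a ∷ w) (suc i) = posTail w i

pos : ∀ {k} → List (Subset k) → ℕ → Maybe (Sym k)
pos w zero    = just #
pos w (suc i) = posTail w i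

data Dir : Set where
  ⇓ ⇑ ⇒ ⇐ : Dir

data XForm (k : ℕ) : Set where
  atom : Fin k → XForm k
  ⊤x   : XForm k
  ¬x   : XForm k → XForm k
  _∧x_ : XForm k → XForm k → XForm k
  until : Dir → XForm k → XForm k → XForm k

-- POTL formulas (the operators needed for ι; ∨ is taken as primitive)
data PForm (k : ℕ) : Set where
  atom : Fin k → PForm k
  ⊤p   : PForm k
  ¬p   : PForm k → PForm k
  _∧p_ : PForm k → PForm k → PForm k
  _∨p_ : PForm k → PForm k → PForm k
  ○d ⊖d ○dχ ⊖dχ : PForm k → PForm k
  _Udχ_ _Sdχ_   : PForm k → PForm k → PForm k
  ○uH ⊖uH       : PForm k → PForm k
  _UuH_ _SuH_   : PForm k → PForm k → PForm k
  ○χ ⊖χ         : Prec → PForm k → PForm k   -- restricted ○^π_χ, ⊖^π_χ (used with π ∈ {⋖,≐})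
  ○⋖ ⊖⋖         : PForm k → PForm k

ι : ∀ {k} → XForm k → PForm k
ι (atom a) = atom a
ι ⊤x = ⊤p
ι (¬x φ) = ¬p (ι φ)
ι (φ ∧x ψ) = ι φ ∧p ι ψ
ι (until ⇓ φ ψ) = ○d (ι φ Udχ ι ψ) ∨p ○dχ (ι φ Udχ ι ψ)
ι (until ⇑ φ ψ) = ⊖d (ι φ Sdχ ι ψ) ∨p ⊖dχ (ι φ Sdχ ι ψ)
ι (until ⇒ φ ψ) =
  ((○uH (ι φ UuH ι ψ)
   ∨p (¬p (○uH (⊤p UuH ¬p (ι φ))) ∧p ⊖χ ⋖ (○χ ≐ (ι ψ))))
   ∨p ⊖⋖ (○χ ⋖ (ι ψ ∧p ¬p (⊖uH (⊤p SuH ¬p (ι φ))))))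
   ∨p ⊖⋖ (○χ ≐ (ι ψ) ∧p ¬p (○χ ⋖ (¬p (ι φ))))
ι (until ⇐ φ ψ) =
  ((⊖uH (ι φ SuH ι ψ)
   ∨p ⊖χ ≐ (○χ ⋖ (¬p (○uH ⊤p) ∧p (ι φ SuH ι ψ))))
   ∨p (⊖χ ⋖ (○⋖ (ι ψ)) ∧p ¬p (⊖uH (⊤p SuH ¬p (ι φ)))))
   ∨p ⊖χ ≐ (○⋖ (ι ψ) ∧p ¬p (○χ ⋖ (¬p (ι φ))))

-- Semantics, for a fixed OPM and word w (positions are natural numbers;
-- position 0 and n+1 carry #, positions 1..n carry the letters of w).

module Sem {k : ℕ} (O : OPM k) (w : List (Subset k)) where

  rel : Maybe (Sym k) → Maybe (Sym k) → Maybe Prec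
  rel (just a) (just b) = M O a b
  rel _ _ = nothing

  _⟨_⟩_ : ℕ → Prec → ℕ → Set
  i ⟨ π ⟩ j = rel (pos w i) (pos w j) ≡ just π

  Defined : ℕ → ℕ → Set
  Defined i j = Σ Prec λ π → i ⟨ π ⟩ j

  -- Chains occurring in #w#, given by the positions of their contexts.
  -- Chain i j : positions i < p₁ < … < p_ℓ < j with i ⋖ p₁ ≐ … ≐ p_ℓ ⋗ j,
  -- where each gap between consecutive p's (and the contexts) is either
  -- empty or itself a chain.
  mutual
    data Chain : ℕ → ℕ → Set where
      chain : ∀ {i p j} → i ⟨ ⋖ ⟩ p → Gap i p → Tail p j → Chain i j

    data Tail : ℕ → ℕ → Set where
      last : ∀ {p j} → p ⟨ ⋗ ⟩ j → Gap p j → Tail p j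
      step : ∀ {p q j} → p ⟨ ≐ ⟩ q → Gap p q → Tail q j → Tail p j

    data Gap : ℕ → ℕ → Set where
      adj  : ∀ {p} → Gap p (suc p)
      nest : ∀ {p q} → Chain p q → Gap p q

  χ : ℕ → ℕ → Set
  χ i j = suc i < j × Chain i j

  Compatible : Set
  Compatible =
    (∀ i → 1 ≤ i → (a b : Subset k) → pos w i ≡ just (` a) → pos w (suc i) ≡ just (` b) → Defined i (suc i))
    × (∀ i j → Chain i j → Defined i j)

  ⋖or≐ : ℕ → ℕ → Set
  ⋖or≐ i j = i ⟨ ⋖ ⟩ j ⊎ i ⟨ ≐ ⟩ j

  χd : ℕ → ℕ → Set
  χd i j = χ i j × ⋖or≐ i j

  -- The tree τ(w), represented on positions: τ(i) ↦ i.

  Child : ℕ → ℕ → Set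
  Child i j = (i ⟨ ≐ ⟩ suc i × j ≡ suc i)
            ⊎ (i ⟨ ⋖ ⟩ suc i × (j ≡ suc i ⊎ χd i j))

  -- a R⇒ b : b is the next sibling of a among the ordered children
  -- τ(i+1), τ(j₁), …, τ(j_m) of some τ(i) with i ⋖ i+1.
  NextSib : ℕ → ℕ → Set
  NextSib a b = Σ ℕ λ i → i ⟨ ⋖ ⟩ suc i × (a ≡ suc i ⊎ χd i a) × χd i b × a < b
                  × (∀ c → a < c → c < b → ¬ χd i c)

  InTree : ℕ → Set
  InTree i = Star Child 0 i

  R : Dir → ℕ → ℕ → Set
  R ⇓ x y = Child x y
  R ⇑ x y = Child y x
  R ⇒ x y = NextSib x y
  R ⇐ x y = NextSib y x

  Holds : Fin k → ℕ → Set
  Holds a i = Σ (Subset k) λ S → pos w i ≡ just (` S) × a ∈ S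

  TreeSat : XForm k → ℕ → Set
  TreeSat (atom a) i = Holds a i
  TreeSat ⊤x i = ⊤
  TreeSat (¬x φ) i = ¬ TreeSat φ i
  TreeSat (φ ∧x ψ) i = TreeSat φ i × TreeSat ψ i
  TreeSat (until ρ φ ψ) s =
    Σ ℕ λ t → TransClosure (R ρ) s t × TreeSat ψ t
      × (∀ r → TransClosure (R ρ) s r → TransClosure (R ρ) r t → TreeSat φ r)

  -- Downward summary path from i to j; P holds at every position where a
  -- step starts (all positions but j), Q at every position where a step
  -- ends (all positions but i).
  data DSP (P Q : ℕ → Set) (j : ℕ) : ℕ → Set where
    done : DSP P Q j j
    jump : ∀ {i h} → P i → Q h → h ≤ j → χd i h
         → (∀ h' → h < h' → h' ≤ j → ¬ χd i h')
         → DSP P Q j h → DSP P Q j i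
    next : ∀ {i} → P i → Q (suc i) → (∀ h → h ≤ j → ¬ χd i h)
         → ⋖or≐ i (suc i) → DSP P Q j (suc i) → DSP P Q j i

  χ⋖ : ℕ → ℕ → Set
  χ⋖ h i = χ h i × h ⟨ ⋖ ⟩ i

  data UHP (h : ℕ) (P Q : ℕ → Set) (j : ℕ) : ℕ → Set where
    done : χ⋖ h j → UHP h P Q j j
    step : ∀ {i i'} → P i → Q i' → χ⋖ h i → i < i'
         → (∀ m → i < m → m < i' → ¬ χ h m)
         → UHP h P Q j i' → UHP h P Q j i

  PSat : PForm k → ℕ → Set
  PSat (atom a) i = Holds a i
  PSat ⊤p i = ⊤
  PSat (¬p θ) i = ¬ PSat θ i
  PSat (θ ∧p η) i = PSat θ i × PSat η i
  PSat (θ ∨p η) i = PSat θ i ⊎ PSat η i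
  PSat (○d θ) i = ⋖or≐ i (suc i) × PSat θ (suc i)
  PSat (⊖d θ) zero = ⊥
  PSat (⊖d θ) (suc i) = ⋖or≐ i (suc i) × PSat θ i
  PSat (○dχ θ) i = Σ ℕ λ j → i < j × χ i j × ⋖or≐ i j × PSat θ j
  PSat (⊖dχ θ) i = Σ ℕ λ j → j < i × χ j i × ⋖or≐ j i × PSat θ j
  PSat (θ Udχ η) i = Σ ℕ λ j → i ≤ j × DSP (PSat θ) (λ _ → ⊤) j i × PSat η j
  PSat (θ Sdχ η) i = Σ ℕ λ j → j ≤ i × DSP (λ _ → ⊤) (PSat θ) i j × PSat η j
  PSat (○uH θ) i = Σ ℕ λ h → h < i × χ⋖ h i × Σ ℕ λ j → i < j × χ⋖ h j
                     × (∀ m → i < m → m < j → ¬ χ⋖ h m) × PSat θ j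
  PSat (⊖uH θ) i = Σ ℕ λ h → h < i × χ⋖ h i × Σ ℕ λ j → j < i × χ⋖ h j
                     × (∀ m → j < m → m < i → ¬ χ⋖ h m) × PSat θ j
  PSat (θ UuH η) i = Σ ℕ λ j → i ≤ j × Σ ℕ λ h → h < i × UHP h (PSat θ) (λ _ → ⊤) j i × PSat η j
  PSat (θ SuH η) i = Σ ℕ λ j → j ≤ i × Σ ℕ λ h → h < j × UHP h (λ _ → ⊤) (PSat θ) i j × PSat η j
  PSat (○χ π θ) i = Σ ℕ λ j → χ i j × i ⟨ π ⟩ j × PSat θ j
  PSat (⊖χ π θ) i = Σ ℕ λ j → j < i × χ j i × j ⟨ π ⟩ i × PSat θ j
  PSat (○⋖ θ) i = i ⟨ ⋖ ⟩ suc i × PSat θ (suc i)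
  PSat (⊖⋖ θ) zero = ⊥
  PSat (⊖⋖ θ) (suc i) = i ⟨ ⋖ ⟩ suc i × PSat θ i

{-# OPTIONS --safe #-}
-- The children of τ(i) are the positions c with i ⋖ c or i ≐ c that are
-- either i+1 or the right context of a chain with left context i, i.e. the
-- positions reached by ○ᵈ and ○ᵈ_χ.  Chains of #w# never cross, so every
-- position between a node and one of its descendants is again a descendant,
-- and a later sibling lies beyond all descendants of an earlier one.  Hence,
-- descending towards τ(j), the next node is the farthest χ-successor not
-- beyond j, or else the next position: the downward summary path from a child
-- c of τ(i) to j is exactly the tree path from c to j.
module Submission where

open import Defs
open import Data.Nat using (ℕ; suc; s≤s; _≤_; _<_; _≤?_; _<?_)
open import Data.Nat.Properties
open import Data.List using (List)
open import Data.Fin.Subset using (Subset)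
open import Data.Product using (∃-syntax; _×_; _,_)
open import Data.Sum using (_⊎_; inj₁; inj₂)
open import Data.Unit using (⊤; tt)
open import Data.Empty using (⊥; ⊥-elim)
open import Data.Maybe.Properties using (just-injective)
open import Function.Base using (case_of_)
open import Function.Bundles using (_⇔_; mk⇔; Equivalence)
open import Function.Properties.Equivalence using () renaming (sym to ⇔-sym; trans to ⇔-trans)
open import Relation.Nullary using (¬_; yes; no)
open import Relation.Binary using (Rel; tri<; tri≈; tri>)
open import Relation.Binary.PropositionalEquality using (_≡_; refl; sym; trans)
open import Relation.Binary.Construct.Closure.Transitive using (TransClosure; [_]; _∷_)
open import Relation.Binary.Construct.Closure.ReflexiveTransitive using (Star; ε; _◅_; _◅◅_)

module _ {a ℓ} {A : Set a} {_∼_ : Rel A ℓ} where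

  ⁺⇒* : ∀ {x y} → TransClosure _∼_ x y → Star _∼_ x y
  ⁺⇒* [ x∼y ]      = x∼y ◅ ε
  ⁺⇒* (x∼y ∷ y∼⁺z) = x∼y ◅ ⁺⇒* y∼⁺z

  ∼◅*⇒⁺ : ∀ {x y z} → x ∼ y → Star _∼_ y z → TransClosure _∼_ x z
  ∼◅*⇒⁺ x∼y ε           = [ x∼y ]
  ∼◅*⇒⁺ x∼y (y∼u ◅ u∼*z) = x∼y ∷ ∼◅*⇒⁺ y∼u u∼*z

  ⁺⇒∼◅* : ∀ {x z} → TransClosure _∼_ x z → ∃[ y ] x ∼ y × Star _∼_ y z
  ⁺⇒∼◅* [ x∼y ]      = _ , x∼y , ε
  ⁺⇒∼◅* (x∼y ∷ y∼⁺z) = _ , x∼y , ⁺⇒* y∼⁺z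

  *-unsnoc : ∀ {x z} → Star _∼_ x z → x ≡ z ⊎ ∃[ y ] Star _∼_ x y × y ∼ z
  *-unsnoc ε = inj₁ refl
  *-unsnoc (x∼u ◅ u∼*z) with *-unsnoc u∼*z
  ... | inj₁ refl              = inj₂ (_ , ε , x∼u)
  ... | inj₂ (y , u∼*y , y∼z) = inj₂ (y , x∼u ◅ u∼*y , y∼z)

no-nat-between : ∀ {m n} → m < n → n < suc m → ⊥
no-nat-between m<n n<1+m = <⇒≱ m<n (≤-pred n<1+m)

module TreeOfWord {k : ℕ} (O : OPM k) (w : List (Subset k)) where
  open Sem O w

  ⟨⟩-functional : ∀ {i j π π′} → i ⟨ π ⟩ j → i ⟨ π′ ⟩ j → π ≡ π′
  ⟨⟩-functional p q = just-injective (trans (sym p) q)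

  ⋗⇒¬⋖or≐ : ∀ {i j} → i ⟨ ⋗ ⟩ j → ¬ ⋖or≐ i j
  ⋗⇒¬⋖or≐ {i} {j} gt (inj₁ lt) = case ⟨⟩-functional {i} {j} gt lt of λ ()
  ⋗⇒¬⋖or≐ {i} {j} gt (inj₂ eq) = case ⟨⟩-functional {i} {j} gt eq of λ ()

  mutual
    gap-< : ∀ {i j} → Gap i j → i < j
    gap-< adj      = n<1+n _
    gap-< (nest c) = <-trans (n<1+n _) (chain-< c)

    chain-< : ∀ {i j} → Chain i j → suc i < j
    chain-< (chain _ g tl) = ≤-trans (s≤s (gap-< g)) (tail-< tl)

    tail-< : ∀ {i j} → Tail i j → i < j
    tail-< (last _ g)    = gap-< g
    tail-< (step _ g tl) = <-trans (gap-< g) (tail-< tl)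

  chain⇒⋖suc : ∀ {i j} → Chain i j → i ⟨ ⋖ ⟩ suc i
  chain⇒⋖suc (chain lt adj _)      = lt
  chain⇒⋖suc (chain _ (nest c) _) = chain⇒⋖suc c

  -- r can only be the last body position of a chain whose right context is h.
  mutual
    gap-⋗ : ∀ {p h r} → Gap p h → p < r → r < h → Gap r h → r ⟨ ⋗ ⟩ h
    gap-⋗ adj      p<r r<h _ = ⊥-elim (no-nat-between p<r r<h)
    gap-⋗ (nest c) p<r r<h G = chain-⋗ c p<r r<h G

    chain-⋗ : ∀ {p h r} → Chain p h → p < r → r < h → Gap r h → r ⟨ ⋗ ⟩ h
    chain-⋗ {r = r} (chain {p = q} _ g tl) p<r r<h G with q ≤? r
    ... | yes q≤r = tail-⋗ tl q≤r r<h G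
    ... | no  q≰r = ⊥-elim (gaps-do-not-cross g p<r (≰⇒> q≰r) (tail-< tl) G)

    tail-⋗ : ∀ {p h r} → Tail p h → p ≤ r → r < h → Gap r h → r ⟨ ⋗ ⟩ h
    tail-⋗ t p≤r r<h G with m≤n⇒m<n∨m≡n p≤r
    tail-⋗ (last gt _)    _ _   _ | inj₂ refl = gt
    tail-⋗ (step eq g tl) _ _   G | inj₂ refl = ⊥-elim (step-gap-absurd eq g tl G)
    tail-⋗ (last _ g)     _ r<h G | inj₁ p<r  = gap-⋗ g p<r r<h G
    tail-⋗ {r = r} (step {q = q} _ g tl) _ r<h G | inj₁ p<r with q ≤? r
    ... | yes q≤r = tail-⋗ tl q≤r r<h G
    ... | no  q≰r = ⊥-elim (gaps-do-not-cross g p<r (≰⇒> q≰r) (tail-< tl) G)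

    step-gap-absurd : ∀ {p q h} → p ⟨ ≐ ⟩ q → Gap p q → Tail q h → Gap p h → ⊥
    step-gap-absurd _ g tl adj = no-nat-between (gap-< g) (tail-< tl)
    step-gap-absurd {p} {q} eq g tl (nest (chain {p = s} lt gs ts)) with <-cmp s q
    ... | tri< s<q _ _ = <⇒≱ (tail-< tl) (gap-bounds-tail g (gap-< gs) s<q ts)
    ... | tri≈ _ refl _ = case ⟨⟩-functional {p} {q} lt eq of λ ()
    ... | tri> _ _ q<s = <⇒≱ (tail-< ts) (gap-bounds-tail gs (gap-< g) q<s tl)

    gap-bounds-tail : ∀ {a b y z} → Gap a b → a < y → y < b → Tail y z → z ≤ b
    gap-bounds-tail {b = b} {z = z} G a<y y<b (last _ g) with z ≤? b
    ... | yes z≤b = z≤b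
    ... | no  z≰b = ⊥-elim (gaps-do-not-cross G a<y y<b (≰⇒> z≰b) g)
    gap-bounds-tail {b = b} {y} G a<y y<b (step {q = y′} eq g tl) with <-cmp y′ b
    ... | tri< y′<b _ _ = gap-bounds-tail G (<-trans a<y (gap-< g)) y′<b tl
    ... | tri≈ _ refl _ = case ⟨⟩-functional {y} {b} (gap-⋗ G a<y y<b g) eq of λ ()
    ... | tri> _ _ b<y′ = ⊥-elim (gaps-do-not-cross G a<y y<b b<y′ g)

    gaps-do-not-cross : ∀ {x h y z} → Gap x h → x < y → y < h → h < z → Gap y z → ⊥
    gaps-do-not-cross adj x<y y<h _   _   = no-nat-between x<y y<h
    gaps-do-not-cross _   _   y<h h<z adj = no-nat-between y<h h<z
    gaps-do-not-cross {h = h} {y} G x<y y<h h<z (nest (chain {p = q} lt g tl)) with <-cmp q h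
    ... | tri< q<h _ _ = <⇒≱ h<z (gap-bounds-tail G (<-trans x<y (gap-< g)) q<h tl)
    ... | tri≈ _ refl _ = case ⟨⟩-functional {y} {h} (gap-⋗ G x<y y<h g) lt of λ ()
    ... | tri> _ _ h<q = gaps-do-not-cross G x<y y<h h<q g

  χd⇒child : ∀ {a t} → χd a t → Child a t
  χd⇒child d@((_ , c) , _) = inj₂ (chain⇒⋖suc c , inj₂ d)

  gap⇒child : ∀ {a t} → ⋖or≐ a t → Gap a t → Child a t
  gap⇒child (inj₁ lt) adj      = inj₂ (lt , inj₁ refl)
  gap⇒child (inj₂ eq) adj      = inj₁ (eq , refl)
  gap⇒child r         (nest c) = χd⇒child ((chain-< c , c) , r)

  child⇒gap : ∀ {a t} → Child a t → ⋖or≐ a t × Gap a t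
  child⇒gap (inj₁ (eq , refl))              = inj₂ eq , adj
  child⇒gap (inj₂ (lt , inj₁ refl))         = inj₁ lt , adj
  child⇒gap (inj₂ (_ , inj₂ ((_ , c) , r))) = r , nest c

  child⇒suc⊎χd : ∀ {a t} → Child a t → (t ≡ suc a × ⋖or≐ a t) ⊎ χd a t
  child⇒suc⊎χd (inj₁ (eq , refl))      = inj₁ (refl , inj₂ eq)
  child⇒suc⊎χd (inj₂ (lt , inj₁ refl)) = inj₁ (refl , inj₁ lt)
  child⇒suc⊎χd (inj₂ (_ , inj₂ d))     = inj₂ d

  child-< : ∀ {a t} → Child a t → a < t
  child-< c with child⇒gap c
  ... | _ , g = gap-< g

  descendant-≤ : ∀ {a t} → Star Child a t → a ≤ t
  descendant-≤ ε       = ≤-refl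
  descendant-≤ (c ◅ s) = ≤-trans (<⇒≤ (child-< c)) (descendant-≤ s)

  strict-descendant-< : ∀ {a t} → TransClosure Child a t → a < t
  strict-descendant-< p with ⁺⇒∼◅* p
  ... | _ , c , s = <-≤-trans (child-< c) (descendant-≤ s)

  parent-unique : ∀ {a b t} → Child a t → Child b t → a ≡ b
  parent-unique {a} {b} {t} a→t b→t with child⇒gap a→t | child⇒gap b→t | <-cmp a b
  ... | _ , ga | rb , gb | tri< a<b _ _ = ⊥-elim (⋗⇒¬⋖or≐ {b} {t} (gap-⋗ ga a<b (gap-< gb) gb) rb)
  ... | _ | _ | tri≈ _ a≡b _ = a≡b
  ... | ra , ga | _ , gb | tri> _ _ b<a = ⊥-elim (⋗⇒¬⋖or≐ {a} {t} (gap-⋗ gb b<a (gap-< ga) ga) ra)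

  mutual
    chain-interior-descends : ∀ {p h m} → Chain p h → p < m → m < h → Star Child p m
    chain-interior-descends {m = m} (chain {p = q} lt g tl) p<m m<h with m <? q
    ... | yes m<q = gap-interior-descends g p<m m<q
    ... | no  m≮q = gap⇒child (inj₁ lt) g ◅ tail-interior-descends tl (≮⇒≥ m≮q) m<h

    gap-interior-descends : ∀ {p h m} → Gap p h → p < m → m < h → Star Child p m
    gap-interior-descends adj      p<m m<h = ⊥-elim (no-nat-between p<m m<h)
    gap-interior-descends (nest c) p<m m<h = chain-interior-descends c p<m m<h

    tail-interior-descends : ∀ {p h m} → Tail p h → p ≤ m → m < h → Star Child p m
    tail-interior-descends t p≤m m<h with m≤n⇒m<n∨m≡n p≤m
    ... | inj₂ refl = ε
    tail-interior-descends (last _ g) _ m<h | inj₁ p<m = gap-interior-descends g p<m m<h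
    tail-interior-descends {m = m} (step {q = q} eq g tl) _ m<h | inj₁ p<m with m <? q
    ... | yes m<q = gap-interior-descends g p<m m<q
    ... | no  m≮q = gap⇒child (inj₂ eq) g ◅ tail-interior-descends tl (≮⇒≥ m≮q) m<h

  descendants-interval : ∀ {y t m} → Star Child y t → y ≤ m → m ≤ t → Star Child y m
  descendants-interval ε y≤m m≤t with ≤-antisym y≤m m≤t
  ... | refl = ε
  descendants-interval {y} {m = m} (_◅_ {j = z} y→z z⇝t) y≤m m≤t with m <? z | m≤n⇒m<n∨m≡n y≤m
  ... | no  m≮z | _         = y→z ◅ descendants-interval z⇝t (≮⇒≥ m≮z) m≤t
  ... | yes _   | inj₂ refl = ε
  ... | yes m<z | inj₁ y<m with child⇒gap y→z
  ...   | _ , g = gap-interior-descends g y<m m<z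

  -- h would descend from y, hence so would its parent x, although x < y.
  later-sibling-not-below : ∀ {x y t h} → Child x y → Star Child y t → Child x h → y < h → h ≤ t → ⊥
  later-sibling-not-below x→y y⇝t x→h y<h h≤t with *-unsnoc (descendants-interval y⇝t (<⇒≤ y<h) h≤t)
  ... | inj₁ refl = <-irrefl refl y<h
  ... | inj₂ (p , y⇝p , p→h) with parent-unique p→h x→h
  ...   | refl = <⇒≱ (child-< x→y) (descendant-≤ y⇝p)

  child-on-path-unique : ∀ {x y y′ j} → Child x y → Child x y′ → Star Child y j → Star Child y′ j → y ≡ y′
  child-on-path-unique {y = y} {y′} x→y x→y′ y⇝j y′⇝j with <-cmp y y′
  ... | tri< y<y′ _ _ = ⊥-elim (later-sibling-not-below x→y y⇝j x→y′ y<y′ (descendant-≤ y′⇝j))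
  ... | tri≈ _ y≡y′ _ = y≡y′
  ... | tri> _ _ y′<y = ⊥-elim (later-sibling-not-below x→y′ y′⇝j x→y y′<y (descendant-≤ y⇝j))

  DownUntil : (P Q : ℕ → Set) → ℕ → Set
  DownUntil P Q c = ∃[ t ] Star Child c t × Q t × (∀ r → Star Child c r → TransClosure Child r t → P r)

  -- TreeSat (until ⇓ φ ψ) is definitionally DownUntil⁺ (TreeSat φ) (TreeSat ψ).
  DownUntil⁺ : (P Q : ℕ → Set) → ℕ → Set
  DownUntil⁺ P Q i = ∃[ t ] TransClosure Child i t × Q t
                     × (∀ r → TransClosure Child i r → TransClosure Child r t → P r)

  DownUntil⁺⇔child-DownUntil : ∀ {P Q i} → DownUntil⁺ P Q i ⇔ (∃[ c ] Child i c × DownUntil P Q c)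
  DownUntil⁺⇔child-DownUntil {P} {Q} {i} = mk⇔ to from
    where
    to : DownUntil⁺ P Q i → ∃[ c ] Child i c × DownUntil P Q c
    to (t , i⇝⁺t , Qt , P-above) with ⁺⇒∼◅* i⇝⁺t
    ... | c , i→c , c⇝t = c , i→c , t , c⇝t , Qt , λ r c⇝r → P-above r (∼◅*⇒⁺ i→c c⇝r)

    from : (∃[ c ] Child i c × DownUntil P Q c) → DownUntil⁺ P Q i
    from (c , i→c , t , c⇝t , Qt , P-above) = t , ∼◅*⇒⁺ i→c c⇝t , Qt , P-above′
      where
      P-above′ : ∀ r → TransClosure Child i r → TransClosure Child r t → P r
      P-above′ r i⇝⁺r r⇝⁺t with ⁺⇒∼◅* i⇝⁺r
      ... | c′ , i→c′ , c′⇝r with child-on-path-unique i→c′ i→c (c′⇝r ◅◅ ⁺⇒* r⇝⁺t) c⇝t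
      ...   | refl = P-above r c′⇝r r⇝⁺t

  DownUntil-cong : ∀ {P P′ Q Q′ c} → (∀ r → Star Child c r → P r ⇔ P′ r) → (∀ r → Star Child c r → Q r ⇔ Q′ r)
                 → DownUntil P Q c ⇔ DownUntil P′ Q′ c
  DownUntil-cong P⇔P′ Q⇔Q′ = mk⇔
    (λ (t , c⇝t , Qt , P-above) → t , c⇝t , Equivalence.to (Q⇔Q′ t c⇝t) Qt ,
       λ r c⇝r r⇝⁺t → Equivalence.to (P⇔P′ r c⇝r) (P-above r c⇝r r⇝⁺t))
    (λ (t , c⇝t , Qt , P-above) → t , c⇝t , Equivalence.from (Q⇔Q′ t c⇝t) Qt ,
       λ r c⇝r r⇝⁺t → Equivalence.from (P⇔P′ r c⇝r) (P-above r c⇝r r⇝⁺t))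

  χd-< : ∀ {a h} → χd a h → suc a < h
  χd-< ((a+1<h , _) , _) = a+1<h

  -- The DSP step is forced: any χ-successor of x not beyond t would be a later sibling of y.
  path⇒DSP : ∀ {P x t} → Star Child x t → (∀ r → Star Child x r → TransClosure Child r t → P r)
           → DSP P (λ _ → ⊤) t x
  path⇒DSP ε _ = done
  path⇒DSP {P} {x} {t} (_◅_ {j = y} x→y y⇝t) P-above = first-step (child⇒suc⊎χd x→y)
    where
    Px : P x
    Px = P-above x ε (∼◅*⇒⁺ x→y y⇝t)

    rest : DSP P (λ _ → ⊤) t y
    rest = path⇒DSP y⇝t (λ r y⇝r → P-above r (x→y ◅ y⇝r))

    first-step : (y ≡ suc x × ⋖or≐ x y) ⊎ χd x y → DSP P (λ _ → ⊤) t x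
    first-step (inj₁ (refl , r)) =
      next Px tt (λ h h≤t d → later-sibling-not-below x→y y⇝t (χd⇒child d) (χd-< d) h≤t) r rest
    first-step (inj₂ d) =
      jump Px tt (descendant-≤ y⇝t) d (λ h y<h h≤t d′ → later-sibling-not-below x→y y⇝t (χd⇒child d′) y<h h≤t) rest

  DSP⇒path : ∀ {P Q j x} → DSP P Q j x → Star Child x j
  DSP⇒path done                  = ε
  DSP⇒path (jump _ _ _ d _ rest) = χd⇒child d ◅ DSP⇒path rest
  DSP⇒path (next _ _ _ r rest)   = gap⇒child r adj ◅ DSP⇒path rest

  DSP-uncons : ∀ {P Q j x} → DSP P Q j x → x ≡ j ⊎ (P x × ∃[ y ] Child x y × DSP P Q j y)
  DSP-uncons done                   = inj₁ refl
  DSP-uncons (jump Px _ _ d _ rest) = inj₂ (Px , _ , χd⇒child d , rest)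
  DSP-uncons (next Px _ _ r rest)   = inj₂ (Px , _ , gap⇒child r adj , rest)

  DSP-above : ∀ {P Q j x r} → DSP P Q j x → Star Child x r → TransClosure Child r j → P r
  DSP-above dsp x⇝r r⇝⁺j with DSP-uncons dsp
  ... | inj₁ refl = ⊥-elim (<⇒≱ (strict-descendant-< r⇝⁺j) (descendant-≤ x⇝r))
  DSP-above dsp ε _ | inj₂ (Px , _) = Px
  DSP-above dsp (x→y ◅ y⇝r) r⇝⁺j | inj₂ (_ , _ , x→y′ , rest)
    with child-on-path-unique x→y x→y′ (y⇝r ◅◅ ⁺⇒* r⇝⁺j) (DSP⇒path rest)
  ... | refl = DSP-above rest y⇝r r⇝⁺j

  Udχ⇔DownUntil : ∀ {θ η c} → PSat (θ Udχ η) c ⇔ DownUntil (PSat θ) (PSat η) c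
  Udχ⇔DownUntil = mk⇔
    (λ (j , _ , dsp , ηj) → j , DSP⇒path dsp , ηj , λ r → DSP-above dsp)
    (λ (t , c⇝t , ηt , θ-above) → t , descendant-≤ c⇝t , path⇒DSP c⇝t θ-above , ηt)

  ○ᵈ∨○ᵈχ⇔child : ∀ {θ i} → PSat (○d θ ∨p ○dχ θ) i ⇔ (∃[ c ] Child i c × PSat θ c)
  ○ᵈ∨○ᵈχ⇔child {θ} {i} = mk⇔ to from
    where
    to : PSat (○d θ ∨p ○dχ θ) i → ∃[ c ] Child i c × PSat θ c
    to (inj₁ (r , θc))               = _ , gap⇒child r adj , θc
    to (inj₂ (c , _ , χic , r , θc)) = c , χd⇒child (χic , r) , θc

    from : (∃[ c ] Child i c × PSat θ c) → PSat (○d θ ∨p ○dχ θ) i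
    from (c , i→c , θc) with child⇒suc⊎χd i→c
    ... | inj₁ (refl , r)          = inj₁ (r , θc)
    ... | inj₂ ((i+1<c , χic) , r) = inj₂ (c , <-trans (n<1+n i) i+1<c , (i+1<c , χic) , r , θc)

  ∃child-cong : ∀ {A B : ℕ → Set} {i} → (∀ c → Child i c → A c ⇔ B c)
              → (∃[ c ] Child i c × A c) ⇔ (∃[ c ] Child i c × B c)
  ∃child-cong A⇔B = mk⇔ (λ (c , i→c , Ac) → c , i→c , Equivalence.to (A⇔B c i→c) Ac)
                        (λ (c , i→c , Bc) → c , i→c , Equivalence.from (A⇔B c i→c) Bc)

lemma4p6 : ∀ {k : ℕ} (O : OPM k) (w : List (Subset k)) → Sem.Compatible O w
           → (φ ψ : XForm k)
           → (∀ i' → Sem.InTree O w i' → (Sem.TreeSat O w φ i' ⇔ Sem.PSat O w (ι φ) i'))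
           → (∀ i' → Sem.InTree O w i' → (Sem.TreeSat O w ψ i' ⇔ Sem.PSat O w (ι ψ) i'))
           → ∀ i → Sem.InTree O w i
           → (Sem.TreeSat O w (until ⇓ φ ψ) i ⇔ Sem.PSat O w (ι (until ⇓ φ ψ)) i)
lemma4p6 O w _ φ ψ hφ hψ i i∈T =
  ⇔-trans DownUntil⁺⇔child-DownUntil
    (⇔-trans (∃child-cong λ c i→c →
                ⇔-trans (DownUntil-cong (λ r c⇝r → hφ r (i∈T ◅◅ i→c ◅ c⇝r))
                                        (λ r c⇝r → hψ r (i∈T ◅◅ i→c ◅ c⇝r)))
                        (⇔-sym Udχ⇔DownUntil))
             (⇔-sym (○ᵈ∨○ᵈχ⇔child {ι φ Udχ ι ψ})))
  where open TreeOfWord O w
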